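{- Let $n>k>t$ be positive integers and let $\mathcal{F},\mathcal{G}\subset\binom{[n]}{k}$ be a saturated pair of non-trivial cross $t$-intersecting families. Set $\mathcal{A}_1=\mathcal{T}_t^{(t+1)}(\mathcal{G})$ and $\mathcal{A}_2=\mathcal{T}_t^{(t+1)}(\mathcal{F})$. If $\mathcal{A}_1\neq\emptyset$ and $\mathcal{A}_1\cap\mathcal{A}_2=\emptyset$, then \[ |\mathcal{A}_2|\leq 2(k-t+1). \]
   Context: $\binom{[n]}{k}$ is the family of $k$-subsets of $[n]=\{1,\dots,n\}$. $\mathcal{F},\mathcal{G}$ are cross $t$-intersecting if $|F\cap G|\geq t$ for all $F\in\mathcal{F},G\in\mathcal{G}$; non-trivial if moreover $|\bigcap\{F\colon F\in\mathcal{F}\}|<t$ and $|\bigcap\{G\colon G\in\mathcal{G}\}|<t$; they form a saturated pair if adding any further $k$-subset of $[n]$ to either family destroys the cross $t$-intersecting property. For a family $\mathcal{H}$ of $k$-sets, $\mathcal{T}_t^{(\ell)}(\mathcal{H})=\{T\subset[n]\colon|T|=\ell,\ |T\cap H|\geq t\ \forall H\in\mathcal{H}\}$. -}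

module Defs where

open import Data.Nat using (ℕ; zero; suc; _≤_; _<_; _≡ᵇ_; _≤ᵇ_)
open import Data.Bool using (Bool; true; false; _∧_; _∨_; if_then_else_)
open import Data.Vec using (Vec; []; _∷_)
open import Data.List using (List; []; _∷_; map; _++_; filter; length)
open import Data.Fin.Subset using (Subset; _∩_; ∣_∣; ⋂; inside; outside)
open import Data.Vec.Properties using (≡-dec)
import Data.Bool as B
open import Data.Product using (_×_)
open import Data.Empty using (⊥)
open import Relation.Nullary using (¬_; Dec; yes; no)
open import Relation.Binary.PropositionalEquality using (_≡_)
open import Function using (_∘_)

allL : ∀ {A : Set} → (A → Bool) → List A → Bool
allL p [] = true
allL p (x ∷ xs) = p x ∧ allL p xs

Family : ℕ → Set
Family n = Subset n → Bool

_∈F_ : ∀ {n} → Subset n → Family n → Set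
A ∈F F = F A ≡ true

allSubsets : (n : ℕ) → List (Subset n)
allSubsets zero = [] ∷ []
allSubsets (suc n) = map (outside ∷_) (allSubsets n) ++ map (inside ∷_) (allSubsets n)

members : ∀ {n} → Family n → List (Subset n)
members {n} F = filter (λ A → F A Data.Bool.≟ true) (allSubsets n)

card : ∀ {n} → Family n → ℕ
card F = length (members F)

Uniform : ∀ {n} → ℕ → Family n → Set
Uniform k F = ∀ A → A ∈F F → ∣ A ∣ ≡ k

CrossInt : ∀ {n} → ℕ → Family n → Family n → Set
CrossInt t F G = ∀ A B → A ∈F F → B ∈F G → t ≤ ∣ A ∩ B ∣

-- |⋂ {F : F ∈ 𝓕}| < t   (empty intersection over an empty family = [n]).
NonTrivial : ∀ {n} → ℕ → Family n → Set
NonTrivial t F = ∣ ⋂ (members F) ∣ < t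

insertF : ∀ {n} → Subset n → Family n → Family n
insertF A F B with ≡-dec B._≟_ B A
... | yes _ = true
... | no _ = F B

Saturated : ∀ {n} → ℕ → ℕ → Family n → Family n → Set
Saturated k t F G =
  (∀ A → ∣ A ∣ ≡ k → ¬ (A ∈F F) → ¬ CrossInt t (insertF A F) G) ×
  (∀ A → ∣ A ∣ ≡ k → ¬ (A ∈F G) → ¬ CrossInt t F (insertF A G))

T[_,_] : ∀ {n} → ℕ → ℕ → Family n → Family n
T[ t , ℓ ] H T = (∣ T ∣ ≡ᵇ ℓ) ∧ allL (λ B → t ≤ᵇ ∣ T ∩ B ∣) (members H)

_∩F_ : ∀ {n} → Family n → Family n → Family n
(F ∩F G) A = F A ∧ G A

EmptyF : ∀ {n} → Family n → Set
EmptyF F = ∀ A → ¬ (A ∈F F)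

{-# OPTIONS --safe #-}
-- Pick T ∈ 𝒜₁. As T ∉ 𝒜₂, some A ∈ 𝓕 has |T ∩ A| ≤ t − 1, which forces n ≥ k + 2.
-- Every S ∈ 𝒜₂ meets T in at least t points: otherwise S ∖ T contains a 2-set D, and by
-- saturation 𝓕 contains a k-set P ⊇ T avoiding D (P t-intersects all of 𝒢 because T does),
-- while |S ∩ P| ≤ |S ∖ D| = t − 1. Together with |S ∩ A| ≥ t and |S ∩ T ∩ A| ≤ t − 1, the
-- sizes of S on the four Venn regions of T and A are forced: S = (T ∩ A) ∪ {x , y} with
-- x ∈ T ∖ A and y ∈ A ∖ T, which needs |T ∩ A| = t − 1 and leaves 2 (k − t + 1) choices.
module Submission where

open import Defs
open import Data.Nat using (ℕ; _<_; _≤_; _*_; _+_; _∸_)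
open import Relation.Nullary using (¬_)

open import Data.Nat using (zero; suc; z≤n; s≤s; _≡ᵇ_)
open import Data.Nat.Properties
open import Data.Nat.Combinatorics using (_C_; nCn≡1; nC1≡n; k>n⇒nCk≡0; nCk+nC[k+1]≡[n+1]C[k+1])
open import Data.Nat.Tactic.RingSolver using (solve-∀)
open import Data.Bool using (Bool; true; false; _∧_; T)
import Data.Bool as Bool
open import Data.Bool.Properties using (∧-conicalˡ; ∧-conicalʳ; ∧-zeroʳ; T-≡; ¬-not)
open import Data.Fin.Subset using (Subset; _∩_; ∁; ∣_∣; inside; outside; _⊆_) renaming (⊥ to ∅)
open import Data.Fin.Subset.Properties
  using (∩-assoc; ∩-comm; p∩q⊆p; p∩q⊆q; x∈p∩q⁺; x∈p∩q⁻; p⊆q⇒∣p∣≤∣q∣; ∣p∩q∣≤∣q∣; ∣p∣≤n; ∣∁p∣≡n∸∣p∣;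
         ∣⊥∣≡0; ⊆-min; ⊆-refl; ⊆-antisym; drop-∷-⊆; s⊆s; in⊆in; out⊆; x∈∁p⇒x∉p; x∉p⇒x∈∁p)
open import Data.Vec using ([]; _∷_)
open import Data.Vec.Base using () renaming (here to hereᵛ)
open import Data.Vec.Properties using (≡-dec)
open import Data.List using ([]; _∷_; map; filter; length; _++_)
open import Data.List.Properties using (filter-++; length-++; filter-none)
open import Data.List.Membership.Propositional using () renaming (_∈_ to _∈ˡ_)
open import Data.List.Membership.Propositional.Properties using (∈-filter⁺; ∈-filter⁻; ∈-map⁺; ∈-++⁺ˡ; ∈-++⁺ʳ)
open import Data.List.Relation.Unary.Any using (here; there)
open import Data.List.Relation.Unary.All using (universal)
import Data.List.Relation.Binary.Sublist.Propositional as Sublist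
import Data.List.Relation.Binary.Sublist.Propositional.Properties as Sublistₚ
open import Data.Product using (_×_; _,_; proj₁; proj₂; ∃-syntax)
open import Data.Sum using (_⊎_; inj₁; inj₂; [_,_]′)
open import Data.Empty using (⊥-elim)
open import Function using (_∘_; case_of_)
open import Function.Bundles using (Equivalence)
open import Relation.Nullary using (Dec; yes; no)
open import Relation.Unary using (Pred; Decidable)
open import Relation.Binary.PropositionalEquality

private
  variable
    n k t ℓ : ℕ

toT : ∀ {b} → b ≡ true → T b
toT = Equivalence.from T-≡

fromT : ∀ {b} → T b → b ≡ true
fromT = Equivalence.to T-≡

∣p∣≡∣p∩q∣+∣p∩∁q∣ : ∀ (p q : Subset n) → ∣ p ∣ ≡ ∣ p ∩ q ∣ + ∣ p ∩ ∁ q ∣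
∣p∣≡∣p∩q∣+∣p∩∁q∣ []            []           = refl
∣p∣≡∣p∩q∣+∣p∩∁q∣ (outside ∷ p) (_ ∷ q)      = ∣p∣≡∣p∩q∣+∣p∩∁q∣ p q
∣p∣≡∣p∩q∣+∣p∩∁q∣ (inside ∷ p)  (inside ∷ q) = cong suc (∣p∣≡∣p∩q∣+∣p∩∁q∣ p q)
∣p∣≡∣p∩q∣+∣p∩∁q∣ (inside ∷ p)  (outside ∷ q) =
  trans (cong suc (∣p∣≡∣p∩q∣+∣p∩∁q∣ p q)) (sym (+-suc _ _))

∣p∩q∣≡∣p∩q∩r∣+∣p∩q∩∁r∣ : ∀ (p q r : Subset n) → ∣ p ∩ q ∣ ≡ ∣ p ∩ q ∩ r ∣ + ∣ p ∩ q ∩ ∁ r ∣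
∣p∩q∣≡∣p∩q∩r∣+∣p∩q∩∁r∣ p q r = trans (∣p∣≡∣p∩q∣+∣p∩∁q∣ (p ∩ q) r)
  (cong₂ _+_ (cong ∣_∣ (∩-assoc p q r)) (cong ∣_∣ (∩-assoc p q (∁ r))))

∣p∣+∣∁p∣≡n : ∀ (p : Subset n) → ∣ p ∣ + ∣ ∁ p ∣ ≡ n
∣p∣+∣∁p∣≡n p = trans (cong (∣ p ∣ +_) (∣∁p∣≡n∸∣p∣ p)) (m+[n∸m]≡n (∣p∣≤n p))

m+∣p∩q∣≤∣p∣⇒m+∣q∣≤n : ∀ m (p q : Subset n) → m + ∣ p ∩ q ∣ ≤ ∣ p ∣ → m + ∣ q ∣ ≤ n
m+∣p∩q∣≤∣p∣⇒m+∣q∣≤n {n} m p q m+∣p∩q∣≤∣p∣ = begin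
  m + ∣ q ∣                     ≡⟨ cong (m +_) (∣p∣≡∣p∩q∣+∣p∩∁q∣ q p) ⟩
  m + (∣ q ∩ p ∣ + ∣ q ∩ ∁ p ∣) ≤⟨ +-monoʳ-≤ m (+-mono-≤ (≤-reflexive (cong ∣_∣ (∩-comm q p))) (∣p∩q∣≤∣q∣ q (∁ p))) ⟩
  m + (∣ p ∩ q ∣ + ∣ ∁ p ∣)     ≡⟨ +-assoc m _ _ ⟨
  m + ∣ p ∩ q ∣ + ∣ ∁ p ∣       ≤⟨ +-monoˡ-≤ (∣ ∁ p ∣) m+∣p∩q∣≤∣p∣ ⟩
  ∣ p ∣ + ∣ ∁ p ∣               ≡⟨ ∣p∣+∣∁p∣≡n p ⟩
  n                             ∎
  where open ≤-Reasoning

∩-monoˡ-⊆ : ∀ {p q : Subset n} (r : Subset n) → p ⊆ q → p ∩ r ⊆ q ∩ r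
∩-monoˡ-⊆ {p = p} r p⊆q x∈p∩r with x∈p∩q⁻ p r x∈p∩r
... | x∈p , x∈r = x∈p∩q⁺ (p⊆q x∈p , x∈r)

∩-monoʳ-⊆ : ∀ {p q : Subset n} (r : Subset n) → p ⊆ q → r ∩ p ⊆ r ∩ q
∩-monoʳ-⊆ {p = p} r p⊆q x∈r∩p with x∈p∩q⁻ r p x∈r∩p
... | x∈r , x∈p = x∈p∩q⁺ (x∈r , p⊆q x∈p)

q⊆p⇒∣p∩q∣≡∣q∣ : ∀ (p : Subset n) {q} → q ⊆ p → ∣ p ∩ q ∣ ≡ ∣ q ∣
q⊆p⇒∣p∩q∣≡∣q∣ p {q} q⊆p = cong ∣_∣ (⊆-antisym (p∩q⊆q p q) (λ x∈q → x∈p∩q⁺ (q⊆p x∈q , x∈q)))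

p⊆∁q⇒q⊆∁p : ∀ {p q : Subset n} → p ⊆ ∁ q → q ⊆ ∁ p
p⊆∁q⇒q⊆∁p p⊆∁q x∈q = x∉p⇒x∈∁p (λ x∈p → x∈∁p⇒x∉p (p⊆∁q x∈p) x∈q)

⊆-interpolate : ∀ (p q : Subset n) m → p ⊆ q → ∣ p ∣ ≤ m → m ≤ ∣ q ∣ →
                ∃[ r ] p ⊆ r × r ⊆ q × ∣ r ∣ ≡ m
⊆-interpolate []            []            m p⊆q _ m≤0 = [] , p⊆q , ⊆-refl , sym (n≤0⇒n≡0 m≤0)
⊆-interpolate (inside ∷ p)  (outside ∷ q) m p⊆q _ _ with p⊆q hereᵛ
... | ()
⊆-interpolate (inside ∷ p)  (inside ∷ q)  (suc m) p⊆q (s≤s ∣p∣≤m) (s≤s m≤∣q∣)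
  with r , p⊆r , r⊆q , ∣r∣≡m ← ⊆-interpolate p q m (drop-∷-⊆ p⊆q) ∣p∣≤m m≤∣q∣
  = inside ∷ r , in⊆in p⊆r , in⊆in r⊆q , cong suc ∣r∣≡m
⊆-interpolate (outside ∷ p) (outside ∷ q) m p⊆q ∣p∣≤m m≤∣q∣
  with r , p⊆r , r⊆q , ∣r∣≡m ← ⊆-interpolate p q m (drop-∷-⊆ p⊆q) ∣p∣≤m m≤∣q∣
  = outside ∷ r , s⊆s p⊆r , s⊆s r⊆q , ∣r∣≡m
⊆-interpolate (outside ∷ p) (inside ∷ q)  m p⊆q ∣p∣≤m m≤1+∣q∣ with m ≤? ∣ q ∣
... | yes m≤∣q∣ with r , p⊆r , r⊆q , ∣r∣≡m ← ⊆-interpolate p q m (drop-∷-⊆ p⊆q) ∣p∣≤m m≤∣q∣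
  = outside ∷ r , s⊆s p⊆r , out⊆ r⊆q , ∣r∣≡m
... | no m≰∣q∣ = inside ∷ q , p⊆q , ⊆-refl , ≤-antisym (≰⇒> m≰∣q∣) m≤1+∣q∣

∈-allSubsets : ∀ (p : Subset n) → p ∈ˡ allSubsets n
∈-allSubsets []            = here refl
∈-allSubsets (outside ∷ p) = ∈-++⁺ˡ (∈-map⁺ (outside ∷_) (∈-allSubsets p))
∈-allSubsets (inside ∷ p)  = ∈-++⁺ʳ (map (outside ∷_) (allSubsets _)) (∈-map⁺ (inside ∷_) (∈-allSubsets p))

_∈?F_ : ∀ (A : Subset n) (F : Family n) → Dec (A ∈F F)
A ∈?F F = F A Bool.≟ true

∈F⇒∈members : ∀ (F : Family n) {A} → A ∈F F → A ∈ˡ members F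
∈F⇒∈members F {A} A∈F = ∈-filter⁺ (_∈?F F) (∈-allSubsets A) A∈F

∈members⇒∈F : ∀ (F : Family n) {A} → A ∈ˡ members F → A ∈F F
∈members⇒∈F {n} F A∈ = proj₂ (∈-filter⁻ (_∈?F F) {xs = allSubsets n} A∈)

nonEmpty⇒∃∈F : ∀ (F : Family n) → ¬ EmptyF F → ∃[ A ] A ∈F F
nonEmpty⇒∃∈F F F≢∅ with members F in eq
... | A ∷ _ = A , ∈members⇒∈F F (subst (A ∈ˡ_) (sym eq) (here refl))
... | []    = ⊥-elim (F≢∅ λ A A∈F → case subst (A ∈ˡ_) eq (∈F⇒∈members F A∈F) of λ ())

card-mono : ∀ {F G : Family n} → (∀ A → A ∈F F → A ∈F G) → card F ≤ card G
card-mono {F = F} {G} F⊆G = Sublistₚ.length-mono-≤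
  (Sublistₚ.filter⁺ (_∈?F F) (_∈?F G) (λ { refl → F⊆G _ }) (Sublist.⊆-refl {x = allSubsets _}))

card-∅ : ∀ (F : Family n) → (∀ A → F A ≡ false) → card F ≡ 0
card-∅ F F≡∅ = cong length (filter-none (_∈?F F)
  (universal (λ A A∈F → case trans (sym (F≡∅ A)) A∈F of λ ()) (allSubsets _)))

length-filter-map : ∀ {p} {A B : Set} {P : Pred B p} (P? : Decidable P) (f : A → B) xs →
                    length (filter P? (map f xs)) ≡ length (filter (P? ∘ f) xs)
length-filter-map P? f []       = refl
length-filter-map P? f (x ∷ xs) with P? (f x)
... | yes _ = cong suc (length-filter-map P? f xs)
... | no _  = length-filter-map P? f xs

card-split : ∀ (F : Family (suc n)) → card F ≡ card (F ∘ (outside ∷_)) + card (F ∘ (inside ∷_))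
card-split {n} F = begin
  length (filter P? (map (outside ∷_) L ++ map (inside ∷_) L))
    ≡⟨ cong length (filter-++ P? (map (outside ∷_) L) _) ⟩
  length (filter P? (map (outside ∷_) L) ++ filter P? (map (inside ∷_) L))
    ≡⟨ length-++ (filter P? (map (outside ∷_) L)) ⟩
  length (filter P? (map (outside ∷_) L)) + length (filter P? (map (inside ∷_) L))
    ≡⟨ cong₂ _+_ (length-filter-map P? (outside ∷_) L) (length-filter-map P? (inside ∷_) L) ⟩
  card (F ∘ (outside ∷_)) + card (F ∘ (inside ∷_)) ∎
  where
  open ≡-Reasoning
  P? = _∈?F F
  L  = allSubsets n

allL-true⁻ : ∀ {A : Set} {p : A → Bool} {xs} → allL p xs ≡ true → ∀ {x} → x ∈ˡ xs → p x ≡ true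
allL-true⁻ {p = p} {y ∷ ys} h (here refl) = ∧-conicalˡ (p y) _ h
allL-true⁻ {p = p} {y ∷ ys} h (there x∈) = allL-true⁻ (∧-conicalʳ (p y) _ h) x∈

allL-false⁻ : ∀ {A : Set} {p : A → Bool} xs → allL p xs ≡ false → ∃[ x ] x ∈ˡ xs × p x ≡ false
allL-false⁻ {p = p} (y ∷ ys) h with p y in eq
... | false = y , here refl , eq
... | true with x , x∈ , px ← allL-false⁻ ys h = x , there x∈ , px

∈T⁻ : ∀ (H : Family n) S → S ∈F T[ t , ℓ ] H → ∣ S ∣ ≡ ℓ × (∀ B → B ∈F H → t ≤ ∣ S ∩ B ∣)
∈T⁻ H S S∈T = ≡ᵇ⇒≡ _ _ (toT (∧-conicalˡ _ _ S∈T)) ,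
  λ B B∈H → ≤ᵇ⇒≤ _ _ (toT (allL-true⁻ (∧-conicalʳ _ _ S∈T) (∈F⇒∈members H B∈H)))

∉T⁻ : ∀ (H : Family n) S → ∣ S ∣ ≡ ℓ → ¬ S ∈F T[ t , ℓ ] H → ∃[ B ] B ∈F H × ∣ S ∩ B ∣ < t
∉T⁻ H S ∣S∣≡ℓ S∉T
  with B , B∈ , fails ← allL-false⁻ (members H) (¬-not λ all → S∉T (cong₂ _∧_ (fromT (≡⇒≡ᵇ _ _ ∣S∣≡ℓ)) all))
  = B , ∈members⇒∈F H B∈ , ≰⇒> λ t≤ → subst T fails (≤⇒≤ᵇ t≤)

∈insertF⁻ : ∀ (P : Subset n) (F : Family n) {A} → A ∈F insertF P F → A ≡ P ⊎ A ∈F F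
∈insertF⁻ P F {A} A∈ with ≡-dec Bool._≟_ A P
... | yes A≡P = inj₁ A≡P
... | no _    = inj₂ A∈

saturated⇒∈F : ∀ {F G : Family n} → Saturated k t F G → CrossInt t F G →
               ∀ P → ∣ P ∣ ≡ k → (∀ B → B ∈F G → t ≤ ∣ P ∩ B ∣) → P ∈F F
saturated⇒∈F {F = F} {G} (F-saturated , _) cross P ∣P∣≡k t≤∣P∩G∣ with P ∈?F F
... | yes P∈F = P∈F
... | no P∉F  = ⊥-elim (F-saturated P ∣P∣≡k P∉F cross′)
  where
  cross′ : CrossInt _ (insertF P F) G
  cross′ A B A∈ B∈G =
    [ (λ { refl → t≤∣P∩G∣ B B∈G }) , (λ A∈F → cross A B A∈F B∈G) ]′ (∈insertF⁻ P F A∈)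

saturated⇒∃avoiding : ∀ {F G : Family n} → Saturated k t F G → CrossInt t F G →
  ∀ T → ∣ T ∣ ≤ k → (∀ B → B ∈F G → t ≤ ∣ T ∩ B ∣) →
  ∀ D → D ⊆ ∁ T → ∣ D ∣ + k ≤ n → ∃[ P ] P ∈F F × P ⊆ ∁ D
saturated⇒∃avoiding {k = k} {t} {G = G} sat cross T ∣T∣≤k t≤∣T∩G∣ D D⊆∁T ∣D∣+k≤n
  with P , T⊆P , P⊆∁D , ∣P∣≡k ← ⊆-interpolate T (∁ D) k (p⊆∁q⇒q⊆∁p D⊆∁T) ∣T∣≤k
         (+-cancelˡ-≤ (∣ D ∣) k (∣ ∁ D ∣) (subst (∣ D ∣ + k ≤_) (sym (∣p∣+∣∁p∣≡n D)) ∣D∣+k≤n))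
  = P , saturated⇒∈F sat cross P ∣P∣≡k t≤∣P∩G∣ , P⊆∁D
  where
  t≤∣P∩G∣ : ∀ B → B ∈F G → t ≤ ∣ P ∩ B ∣
  t≤∣P∩G∣ B B∈G = ≤-trans (t≤∣T∩G∣ B B∈G) (p⊆q⇒∣p∣≤∣q∣ (∩-monoˡ-⊆ B T⊆P))

-- Counting sets by their sizes on the Venn regions of two sets

vennCounts : Subset n → Subset n → ℕ → ℕ → ℕ → ℕ → Family n
vennCounts X Y a b c d S =
  (∣ S ∩ X ∩ Y ∣ ≡ᵇ a) ∧ (∣ S ∩ X ∩ ∁ Y ∣ ≡ᵇ b) ∧ (∣ S ∩ ∁ X ∩ Y ∣ ≡ᵇ c) ∧ (∣ S ∩ ∁ X ∩ ∁ Y ∣ ≡ᵇ d)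

private
  distrib₁ : ∀ p q x y z → p * x * y * z + q * x * y * z ≡ (p + q) * x * y * z
  distrib₁ = solve-∀
  distrib₂ : ∀ p q x y z → x * p * y * z + x * q * y * z ≡ x * (p + q) * y * z
  distrib₂ = solve-∀
  distrib₃ : ∀ p q x y z → x * y * p * z + x * y * q * z ≡ x * y * (p + q) * z
  distrib₃ = solve-∀
  distrib₄ : ∀ p q x y z → x * y * z * p + x * y * z * q ≡ x * y * z * (p + q)
  distrib₄ = solve-∀

  pascal : ∀ r a → r C suc a + r C a ≡ suc r C suc a
  pascal r a = trans (+-comm (r C suc a) _) (nCk+nC[k+1]≡[n+1]C[k+1] r a)

  pascal₁ : ∀ r a x y z → (r C suc a) * x * y * z + (r C a) * x * y * z ≡ (suc r C suc a) * x * y * z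
  pascal₁ r a x y z = trans (distrib₁ (r C suc a) (r C a) x y z) (cong (λ m → m * x * y * z) (pascal r a))
  pascal₂ : ∀ r a x y z → x * (r C suc a) * y * z + x * (r C a) * y * z ≡ x * (suc r C suc a) * y * z
  pascal₂ r a x y z = trans (distrib₂ (r C suc a) (r C a) x y z) (cong (λ m → x * m * y * z) (pascal r a))
  pascal₃ : ∀ r a x y z → x * y * (r C suc a) * z + x * y * (r C a) * z ≡ x * y * (suc r C suc a) * z
  pascal₃ r a x y z = trans (distrib₃ (r C suc a) (r C a) x y z) (cong (λ m → x * y * m * z) (pascal r a))
  pascal₄ : ∀ r a x y z → x * y * z * (r C suc a) + x * y * z * (r C a) ≡ x * y * z * (suc r C suc a)
  pascal₄ r a x y z = trans (distrib₄ (r C suc a) (r C a) x y z) (cong (λ m → x * y * z * m) (pascal r a))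

  card-split≡ : ∀ n {F : Family (suc n)} {m₀ m₁ m} → card (F ∘ (outside ∷_)) ≡ m₀ →
                card (F ∘ (inside ∷_)) ≡ m₁ → m₀ + m₁ ≡ m → card F ≡ m
  card-split≡ _ {F} refl refl m₀+m₁≡m = trans (card-split F) m₀+m₁≡m

  ∧-zero₂ : ∀ x y → x ∧ y ∧ false ≡ false
  ∧-zero₂ x y = trans (cong (x ∧_) (∧-zeroʳ y)) (∧-zeroʳ x)

  ∧-zero₃ : ∀ x y z → x ∧ y ∧ z ∧ false ≡ false
  ∧-zero₃ x y z = trans (cong (x ∧_) (∧-zero₂ y z)) (∧-zeroʳ x)

  card-split-∅ : ∀ n {F : Family (suc n)} {m} → card (F ∘ (outside ∷_)) ≡ m →
                 (∀ S → F (inside ∷ S) ≡ false) → card F ≡ m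
  card-split-∅ n {F} card≡m inside-∅ = card-split≡ n card≡m (card-∅ (F ∘ (inside ∷_)) inside-∅) (+-identityʳ _)

card-vennCounts : ∀ (X Y : Subset n) a b c d → card (vennCounts X Y a b c d) ≡
  (∣ X ∩ Y ∣ C a) * (∣ X ∩ ∁ Y ∣ C b) * (∣ ∁ X ∩ Y ∣ C c) * (∣ ∁ X ∩ ∁ Y ∣ C d)
card-vennCounts [] [] zero    zero    zero    zero    = refl
card-vennCounts [] [] (suc a) _       _       _       = refl
card-vennCounts [] [] zero    (suc b) _       _       = refl
card-vennCounts [] [] zero    zero    (suc c) _       = refl
card-vennCounts [] [] zero    zero    zero    (suc d) = refl
card-vennCounts {suc n} (inside ∷ X) (inside ∷ Y) zero b c d =
  card-split-∅ n (card-vennCounts X Y zero b c d) λ _ → refl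
card-vennCounts {suc n} (inside ∷ X) (inside ∷ Y) (suc a) b c d =
  card-split≡ n (card-vennCounts X Y (suc a) b c d) (card-vennCounts X Y a b c d)
    (pascal₁ ∣ X ∩ Y ∣ a (∣ X ∩ ∁ Y ∣ C b) (∣ ∁ X ∩ Y ∣ C c) (∣ ∁ X ∩ ∁ Y ∣ C d))
card-vennCounts {suc n} (inside ∷ X) (outside ∷ Y) a zero c d =
  card-split-∅ n (card-vennCounts X Y a zero c d) λ _ → ∧-zeroʳ _
card-vennCounts {suc n} (inside ∷ X) (outside ∷ Y) a (suc b) c d =
  card-split≡ n (card-vennCounts X Y a (suc b) c d) (card-vennCounts X Y a b c d)
    (pascal₂ ∣ X ∩ ∁ Y ∣ b (∣ X ∩ Y ∣ C a) (∣ ∁ X ∩ Y ∣ C c) (∣ ∁ X ∩ ∁ Y ∣ C d))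
card-vennCounts {suc n} (outside ∷ X) (inside ∷ Y) a b zero d =
  card-split-∅ n (card-vennCounts X Y a b zero d)
    λ S → ∧-zero₂ (∣ S ∩ X ∩ Y ∣ ≡ᵇ a) (∣ S ∩ X ∩ ∁ Y ∣ ≡ᵇ b)
card-vennCounts {suc n} (outside ∷ X) (inside ∷ Y) a b (suc c) d =
  card-split≡ n (card-vennCounts X Y a b (suc c) d) (card-vennCounts X Y a b c d)
    (pascal₃ ∣ ∁ X ∩ Y ∣ c (∣ X ∩ Y ∣ C a) (∣ X ∩ ∁ Y ∣ C b) (∣ ∁ X ∩ ∁ Y ∣ C d))
card-vennCounts {suc n} (outside ∷ X) (outside ∷ Y) a b c zero =
  card-split-∅ n (card-vennCounts X Y a b c zero)
    λ S → ∧-zero₃ (∣ S ∩ X ∩ Y ∣ ≡ᵇ a) (∣ S ∩ X ∩ ∁ Y ∣ ≡ᵇ b) (∣ S ∩ ∁ X ∩ Y ∣ ≡ᵇ c)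
card-vennCounts {suc n} (outside ∷ X) (outside ∷ Y) a b c (suc d) =
  card-split≡ n (card-vennCounts X Y a b c (suc d)) (card-vennCounts X Y a b c d)
    (pascal₄ ∣ ∁ X ∩ ∁ Y ∣ d (∣ X ∩ Y ∣ C a) (∣ X ∩ ∁ Y ∣ C b) (∣ ∁ X ∩ Y ∣ C c))

m+n≡1+o∧m<o⇒2≤n : ∀ {m n o} → m + n ≡ suc o → m < o → 2 ≤ n
m+n≡1+o∧m<o⇒2≤n {m} {n} {o} m+n≡1+o m<o = +-cancelʳ-≤ o 2 n (begin
  2 + o     ≡⟨ cong suc m+n≡1+o ⟨
  suc m + n ≤⟨ +-monoˡ-≤ n m<o ⟩
  o + n     ≡⟨ +-comm o n ⟩
  n + o     ∎)
  where open ≤-Reasoning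

forced-counts : ∀ {u a b c d} → a ≤ u → suc u ≤ a + b → suc u ≤ a + c → (a + b) + (c + d) ≡ 2 + u →
                a ≡ u × b ≡ 1 × c ≡ 1 × d ≡ 0
forced-counts {suc u} {suc a} (s≤s a≤u) (s≤s h₁) (s≤s h₂) eq
  with a≡u , rest ← forced-counts a≤u h₁ h₂ (suc-injective eq) = cong suc a≡u , rest
forced-counts {zero} {zero} {1} {1} {0} _ _ _ _ = refl , refl , refl , refl
forced-counts {zero} {zero} {1} {1} {suc d} _ _ _ ()
forced-counts {zero} {zero} {1} {suc (suc c)} _ _ _ ()
forced-counts {zero} {zero} {suc (suc b)} {suc c} {d} _ _ _ eq =
  case m+n≡0⇒n≡0 b (suc-injective (suc-injective eq)) of λ ()
forced-counts {suc u} {zero} {b} {c} {d} _ h₁ h₂ eq = ⊥-elim (<-irrefl refl (begin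
  4 + u                 ≤⟨ +-monoʳ-≤ 2 (m≤n+m (2 + u) u) ⟩
  (2 + u) + (2 + u)     ≤⟨ +-mono-≤ h₁ h₂ ⟩
  b + c                 ≤⟨ +-monoʳ-≤ b (m≤m+n c d) ⟩
  b + (c + d)           ≡⟨ eq ⟩
  3 + u                 ∎))
  where open ≤-Reasoning

≡⇒≡ᵇ≡true : ∀ {m n} → m ≡ n → (m ≡ᵇ n) ≡ true
≡⇒≡ᵇ≡true m≡n = fromT (≡⇒≡ᵇ _ _ m≡n)

-- Here t = suc u, and 𝒜₁ = T[ t , t + 1 ] G, 𝒜₂ = T[ t , t + 1 ] F.
module _ {u} {F G : Family n}
         (F-uniform : Uniform k F) (cross : CrossInt (suc u) F G) (saturated : Saturated k (suc u) F G)
         (t<k : suc u < k)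
         (T A : Subset n) (T∈A₁ : T ∈F T[ suc u , suc u + 1 ] G) (A∈F : A ∈F F) (∣T∩A∣≤u : ∣ T ∩ A ∣ ≤ u)
         where

  private
    ∣T∣≡2+u : ∣ T ∣ ≡ 2 + u
    ∣T∣≡2+u = trans (proj₁ (∈T⁻ G T T∈A₁)) (+-comm (suc u) 1)

    2+k≤n : 2 + k ≤ n
    2+k≤n = subst (λ m → 2 + m ≤ n) (F-uniform A A∈F)
      (m+∣p∩q∣≤∣p∣⇒m+∣q∣≤n 2 T A (subst (2 + ∣ T ∩ A ∣ ≤_) (sym ∣T∣≡2+u) (+-monoʳ-≤ 2 ∣T∩A∣≤u)))

  A₂-meets-T : ∀ S → S ∈F T[ suc u , suc u + 1 ] F → suc u ≤ ∣ S ∩ T ∣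
  A₂-meets-T S S∈A₂ = ≮⇒≥ ∣S∩T∣≮1+u
    where
    ∣S∣≡2+u : ∣ S ∣ ≡ 2 + u
    ∣S∣≡2+u = trans (proj₁ (∈T⁻ F S S∈A₂)) (+-comm (suc u) 1)

    ∣S∩T∣≮1+u : ¬ ∣ S ∩ T ∣ < suc u
    ∣S∩T∣≮1+u ∣S∩T∣<1+u
      with D , _ , D⊆S∩∁T , ∣D∣≡2 ← ⊆-interpolate ∅ (S ∩ ∁ T) 2
             (⊆-min _) (subst (_≤ 2) (sym (∣⊥∣≡0 n)) z≤n)
             (m+n≡1+o∧m<o⇒2≤n (trans (sym (∣p∣≡∣p∩q∣+∣p∩∁q∣ S T)) ∣S∣≡2+u) ∣S∩T∣<1+u)
      with P , P∈F , P⊆∁D ← saturated⇒∃avoiding saturated cross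
             T (subst (_≤ k) (sym ∣T∣≡2+u) t<k) (proj₂ (∈T⁻ G T T∈A₁))
             D (λ x∈D → p∩q⊆q S (∁ T) (D⊆S∩∁T x∈D)) (subst (λ d → d + k ≤ n) (sym ∣D∣≡2) 2+k≤n)
      = 1+n≰n (begin
          suc u         ≤⟨ proj₂ (∈T⁻ F S S∈A₂) P P∈F ⟩
          ∣ S ∩ P ∣     ≤⟨ p⊆q⇒∣p∣≤∣q∣ (∩-monoʳ-⊆ S P⊆∁D) ⟩
          ∣ S ∩ ∁ D ∣   ≡⟨ ∣S∩∁D∣≡u ⟩
          u             ∎)
      where
      open ≤-Reasoning
      ∣S∩∁D∣≡u : ∣ S ∩ ∁ D ∣ ≡ u
      ∣S∩∁D∣≡u = +-cancelˡ-≡ 2 _ _ (begin-equality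
        2 + ∣ S ∩ ∁ D ∣           ≡⟨ cong (_+ ∣ S ∩ ∁ D ∣)
                                       (trans (q⊆p⇒∣p∩q∣≡∣q∣ S (λ x∈D → p∩q⊆p S (∁ T) (D⊆S∩∁T x∈D))) ∣D∣≡2) ⟨
        ∣ S ∩ D ∣ + ∣ S ∩ ∁ D ∣   ≡⟨ ∣p∣≡∣p∩q∣+∣p∩∁q∣ S D ⟨
        ∣ S ∣                     ≡⟨ ∣S∣≡2+u ⟩
        2 + u                     ∎)

  A₂⊆vennCounts : ∀ S → S ∈F T[ suc u , suc u + 1 ] F → S ∈F vennCounts T A u 1 1 0
  A₂⊆vennCounts S S∈A₂ = counts⇒∈vennCounts (forced-counts ∣S∩T∩A∣≤u
    (subst (suc u ≤_) ∣S∩T∣≡a+b (A₂-meets-T S S∈A₂))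
    (subst (suc u ≤_) ∣S∩A∣≡a+c (proj₂ (∈T⁻ F S S∈A₂) A A∈F))
    (trans (sym ∣S∣≡a+b+c+d) (trans (proj₁ (∈T⁻ F S S∈A₂)) (+-comm (suc u) 1))))
    where
    ∣S∩T∩A∣≤u : ∣ S ∩ T ∩ A ∣ ≤ u
    ∣S∩T∩A∣≤u = ≤-trans (∣p∩q∣≤∣q∣ S (T ∩ A)) ∣T∩A∣≤u

    ∣S∩T∣≡a+b : ∣ S ∩ T ∣ ≡ ∣ S ∩ T ∩ A ∣ + ∣ S ∩ T ∩ ∁ A ∣
    ∣S∩T∣≡a+b = ∣p∩q∣≡∣p∩q∩r∣+∣p∩q∩∁r∣ S T A

    ∣S∩A∣≡a+c : ∣ S ∩ A ∣ ≡ ∣ S ∩ T ∩ A ∣ + ∣ S ∩ ∁ T ∩ A ∣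
    ∣S∩A∣≡a+c = trans (∣p∩q∣≡∣p∩q∩r∣+∣p∩q∩∁r∣ S A T)
      (cong₂ _+_ (cong (λ Z → ∣ S ∩ Z ∣) (∩-comm A T)) (cong (λ Z → ∣ S ∩ Z ∣) (∩-comm A (∁ T))))

    ∣S∣≡a+b+c+d : ∣ S ∣ ≡ (∣ S ∩ T ∩ A ∣ + ∣ S ∩ T ∩ ∁ A ∣) + (∣ S ∩ ∁ T ∩ A ∣ + ∣ S ∩ ∁ T ∩ ∁ A ∣)
    ∣S∣≡a+b+c+d = trans (∣p∣≡∣p∩q∣+∣p∩∁q∣ S T) (cong₂ _+_ ∣S∩T∣≡a+b (∣p∩q∣≡∣p∩q∩r∣+∣p∩q∩∁r∣ S (∁ T) A))

    counts⇒∈vennCounts : ∣ S ∩ T ∩ A ∣ ≡ u × ∣ S ∩ T ∩ ∁ A ∣ ≡ 1 × ∣ S ∩ ∁ T ∩ A ∣ ≡ 1 × ∣ S ∩ ∁ T ∩ ∁ A ∣ ≡ 0 →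
                         S ∈F vennCounts T A u 1 1 0
    counts⇒∈vennCounts (a≡u , b≡1 , c≡1 , d≡0) =
      cong₂ _∧_ (≡⇒≡ᵇ≡true a≡u) (cong₂ _∧_ (≡⇒≡ᵇ≡true b≡1) (cong₂ _∧_ (≡⇒≡ᵇ≡true c≡1) (≡⇒≡ᵇ≡true d≡0)))

  vennCounts-bound : (∣ T ∩ A ∣ C u) * (∣ T ∩ ∁ A ∣ C 1) * (∣ ∁ T ∩ A ∣ C 1) * (∣ ∁ T ∩ ∁ A ∣ C 0)
                     ≤ 2 * (k ∸ suc u + 1)
  vennCounts-bound with m≤n⇒m<n∨m≡n ∣T∩A∣≤u
  ... | inj₁ ∣T∩A∣<u rewrite k>n⇒nCk≡0 ∣T∩A∣<u = z≤n
  ... | inj₂ ∣T∩A∣≡u = ≤-reflexive (begin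
      (∣ T ∩ A ∣ C u) * (∣ T ∩ ∁ A ∣ C 1) * (∣ ∁ T ∩ A ∣ C 1) * 1
        ≡⟨ cong₂ (λ x y → x * y * (∣ ∁ T ∩ A ∣ C 1) * 1)
             (trans (cong (_C u) ∣T∩A∣≡u) (nCn≡1 u)) (trans (nC1≡n _) ∣T∩∁A∣≡2) ⟩
      2 * (∣ ∁ T ∩ A ∣ C 1) * 1
        ≡⟨ cong (λ z → 2 * z * 1) (trans (nC1≡n _) ∣∁T∩A∣≡k∸u) ⟩
      2 * (k ∸ u) * 1
        ≡⟨ *-identityʳ _ ⟩
      2 * (k ∸ u)
        ≡⟨ cong (2 *_) (trans (+-∸-assoc 1 (<⇒≤ t<k)) (+-comm 1 (k ∸ suc u))) ⟩
      2 * (k ∸ suc u + 1) ∎)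
    where
    open ≡-Reasoning

    ∣T∩∁A∣≡2 : ∣ T ∩ ∁ A ∣ ≡ 2
    ∣T∩∁A∣≡2 = +-cancelˡ-≡ u _ 2 (begin
      u + ∣ T ∩ ∁ A ∣           ≡⟨ cong (_+ ∣ T ∩ ∁ A ∣) ∣T∩A∣≡u ⟨
      ∣ T ∩ A ∣ + ∣ T ∩ ∁ A ∣   ≡⟨ ∣p∣≡∣p∩q∣+∣p∩∁q∣ T A ⟨
      ∣ T ∣                     ≡⟨ ∣T∣≡2+u ⟩
      2 + u                     ≡⟨ +-comm 2 u ⟩
      u + 2                     ∎)

    ∣∁T∩A∣≡k∸u : ∣ ∁ T ∩ A ∣ ≡ k ∸ u
    ∣∁T∩A∣≡k∸u = begin
      ∣ ∁ T ∩ A ∣                   ≡⟨ cong ∣_∣ (∩-comm (∁ T) A) ⟩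
      ∣ A ∩ ∁ T ∣                   ≡⟨ m+n∸m≡n u _ ⟨
      u + ∣ A ∩ ∁ T ∣ ∸ u           ≡⟨ cong (λ m → m + ∣ A ∩ ∁ T ∣ ∸ u) (trans (sym ∣T∩A∣≡u) (cong ∣_∣ (∩-comm T A))) ⟩
      ∣ A ∩ T ∣ + ∣ A ∩ ∁ T ∣ ∸ u   ≡⟨ cong (_∸ u) (trans (sym (∣p∣≡∣p∩q∣+∣p∩∁q∣ A T)) (F-uniform A A∈F)) ⟩
      k ∸ u                         ∎

  card-A₂≤ : card (T[ suc u , suc u + 1 ] F) ≤ 2 * (k ∸ suc u + 1)
  card-A₂≤ = begin
    card (T[ suc u , suc u + 1 ] F)
      ≤⟨ card-mono A₂⊆vennCounts ⟩
    card (vennCounts T A u 1 1 0)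
      ≡⟨ card-vennCounts T A u 1 1 0 ⟩
    (∣ T ∩ A ∣ C u) * (∣ T ∩ ∁ A ∣ C 1) * (∣ ∁ T ∩ A ∣ C 1) * (∣ ∁ T ∩ ∁ A ∣ C 0)
      ≤⟨ vennCounts-bound ⟩
    2 * (k ∸ suc u + 1) ∎
    where open ≤-Reasoning

lemma5p3 : (n k t : ℕ) → 0 < t → t < k → k < n →
    (F G : Family n) →
    Uniform k F → Uniform k G →
    CrossInt t F G → NonTrivial t F → NonTrivial t G →
    Saturated k t F G →
    ¬ EmptyF (T[ t , t + 1 ] G) →
    EmptyF (T[ t , t + 1 ] G ∩F T[ t , t + 1 ] F) →
    card (T[ t , t + 1 ] F) ≤ 2 * (k ∸ t + 1)
lemma5p3 _ _ zero () _ _ _ _ _ _ _ _ _ _ _ _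
lemma5p3 n k (suc u) _ t<k _ F G F-uniform _ cross _ _ saturated A₁≢∅ A₁∩A₂≡∅
  with T , T∈A₁ ← nonEmpty⇒∃∈F (T[ suc u , suc u + 1 ] G) A₁≢∅
  with A , A∈F , s≤s ∣T∩A∣≤u ← ∉T⁻ F T (proj₁ (∈T⁻ G T T∈A₁)) (λ T∈A₂ → A₁∩A₂≡∅ T (cong₂ _∧_ T∈A₁ T∈A₂))
  = card-A₂≤ F-uniform cross saturated t<k T A T∈A₁ A∈F ∣T∩A∣≤u
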